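{- Let $\mathcal{A}$ be an $\mathbf{HpsUL}^\ast_\omega$-algebra. Then (i) for all $x,y\in A$: $xy\le e$ iff $xy^2\le e$; (ii) for all $x_1,\dots,x_n\in A$ and all $k_1,\dots,k_n,l_1,\dots,l_n\in\mathbb{Z}_+$: $x_1^{k_1}\cdots x_n^{k_n}\le e$ iff $x_1^{l_1}\cdots x_n^{l_n}\le e$.
   Context: An $\mathbf{HpsUL}$-algebra is an algebra $\mathcal{A}=\langle A,\wedge,\vee,\cdot,\backslash,/,e,f,\bot,\top\rangle$ such that: $\langle A,\wedge,\vee,\bot,\top\rangle$ is a bounded lattice; $\langle A,\cdot,e\rangle$ is a monoid; $xy\le z$ iff $x\le z/y$ iff $y\le x\backslash z$; and $\lambda_u((x\vee y)\backslash x)\vee\rho_v((x\vee y)\backslash y)=e$ for all $x,y,u,v$, where $\lambda_a(b)=(a\backslash(ba))\wedge e$, $\rho_a(b)=((ab)/a)\wedge e$. An $\mathbf{HpsUL}^\ast$-algebra is an $\mathbf{HpsUL}$-algebra satisfying weak commutativity: $xy\le e$ implies $yx\le e$. An $\mathbf{HpsUL}^\ast_\omega$-algebra is an $\mathbf{HpsUL}^\ast$-algebra satisfying $x\backslash e=x^2\backslash e$ for all $x$. Powers: $x^0=e$, $x^{n+1}=x^nx$; $\mathbb{Z}_+$ is the set of positive integers. -}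

module Defs where

open import Level using (Level; suc; _⊔_)
open import Data.Nat using (ℕ; zero) renaming (suc to sucℕ; _<_ to _<ℕ_)
open import Data.Fin using (Fin)
open import Data.Vec.Functional using (Vector; head; tail)
open import Relation.Binary.PropositionalEquality using (_≡_)
open import Function.Bundles using (_⇔_)

record HpsUL (a : Level) : Set (suc a) where
  infixr 6 _∨_
  infixr 7 _∧_
  infixl 8 _·_
  infixr 8 _＼_
  infixl 8 _／_
  field
    A   : Set a
    _∧_ _∨_ _·_ _＼_ _／_ : A → A → A
    e f ⊥ ⊤ : A
    ∧-comm   : ∀ x y → x ∧ y ≡ y ∧ x
    ∨-comm   : ∀ x y → x ∨ y ≡ y ∨ x
    ∧-assoc  : ∀ x y z → (x ∧ y) ∧ z ≡ x ∧ (y ∧ z)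
    ∨-assoc  : ∀ x y z → (x ∨ y) ∨ z ≡ x ∨ (y ∨ z)
    ∧-absorb : ∀ x y → x ∧ (x ∨ y) ≡ x
    ∨-absorb : ∀ x y → x ∨ (x ∧ y) ≡ x
    ⊥-least    : ∀ x → ⊥ ∧ x ≡ ⊥
    ⊤-greatest : ∀ x → x ∧ ⊤ ≡ x
    ·-assoc : ∀ x y z → (x · y) · z ≡ x · (y · z)
    e-identityˡ : ∀ x → e · x ≡ x
    e-identityʳ : ∀ x → x · e ≡ x

  infix 4 _≤_
  _≤_ : A → A → Set a
  x ≤ y = x ∧ y ≡ x

  λ[_] : A → A → A
  λ[ u ] b = (u ＼ (b · u)) ∧ e

  ρ[_] : A → A → A
  ρ[ u ] b = ((u · b) ／ u) ∧ e

  field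
    resid-／ : ∀ x y z → (x · y ≤ z) ⇔ (x ≤ z ／ y)
    resid-＼ : ∀ x y z → (x · y ≤ z) ⇔ (y ≤ x ＼ z)
    prelinearity : ∀ x y u v →
      λ[ u ] ((x ∨ y) ＼ x) ∨ ρ[ v ] ((x ∨ y) ＼ y) ≡ e

  _^_ : A → ℕ → A
  x ^ zero = e
  x ^ sucℕ n = (x ^ n) · x

  prodPow : (n : ℕ) → Vector A n → Vector ℕ n → A
  prodPow zero xs ks = e
  prodPow (sucℕ n) xs ks = (head xs ^ head ks) · prodPow n (tail xs) (tail ks)

record HpsUL* (a : Level) : Set (suc a) where
  field
    hpsUL : HpsUL a
  open HpsUL hpsUL public
  field
    weak-comm : ∀ x y → x · y ≤ e → y · x ≤ e

record HpsUL*ω (a : Level) : Set (suc a) where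
  field
    hpsUL* : HpsUL* a
  open HpsUL* hpsUL* public
  field
    ω-law : ∀ x → x ＼ e ≡ (x ^ 2) ＼ e

-- Weak commutativity lets the factors of a product rotate cyclically without
-- changing whether it lies below e.  Residuation turns u · y ≤ e into u ≤ y ＼ e,
-- so the ω-law gives u · y ≤ e ⇔ u · y² ≤ e; hence any positive power of the last
-- factor may be replaced by its first power, and rotating brings every factor
-- of x₁^k₁ ⋯ xₙ^kₙ to the last position in turn.
module Submission where

open import Defs
open import Level using (Level)
open import Data.Nat using (ℕ; _<_; zero; suc; s≤s; z≤n)
open import Data.Fin using (Fin)
open import Data.Product using (_×_; _,_)
open import Data.Vec.Functional using (Vector; head; tail)
open import Function.Bundles using (_⇔_; mk⇔)
open import Function.Base using (_∘_)
open import Function.Properties.Equivalence using (⇔-setoid)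
open import Relation.Binary.Bundles using (Setoid)
open import Relation.Binary.Core using (Rel)
import Relation.Binary.Construct.On as On
import Relation.Binary.Reasoning.Setoid as SetoidReasoning
open import Relation.Binary.PropositionalEquality using (sym; cong)

module NegativeCone {a : Level} (𝒜 : HpsUL* a) where
  open HpsUL* 𝒜

  infix 4 _∼ₑ_
  _∼ₑ_ : Rel A a
  u ∼ₑ v = (u ≤ e) ⇔ (v ≤ e)

  ∼ₑ-setoid : Setoid a a
  ∼ₑ-setoid = On.setoid (⇔-setoid a) (_≤ e)

  ·-rotate : ∀ u v → u · v ∼ₑ v · u
  ·-rotate u v = mk⇔ (weak-comm u v) (weak-comm v u)

module Absorption {a : Level} (𝒜 : HpsUL*ω a) where
  open HpsUL*ω 𝒜
  open NegativeCone hpsUL* public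
  open Setoid ∼ₑ-setoid using () renaming (refl to ∼ₑ-refl; sym to ∼ₑ-sym)

  ·-square-right : ∀ u y → u · y ∼ₑ u · (y ^ 2)
  ·-square-right u y =
    let open SetoidReasoning (⇔-setoid a) in begin
      u · y ≤ e         ≈⟨ ·-rotate u y ⟩
      y · u ≤ e         ≈⟨ resid-＼ y u e ⟩
      u ≤ y ＼ e        ≡⟨ cong (u ≤_) (ω-law y) ⟩
      u ≤ y ^ 2 ＼ e    ≈⟨ Setoid.sym (⇔-setoid a) (resid-＼ (y ^ 2) u e) ⟩
      y ^ 2 · u ≤ e     ≈⟨ ·-rotate (y ^ 2) u ⟩
      u · (y ^ 2) ≤ e   ∎

  open SetoidReasoning ∼ₑ-setoid

  ·-square-absorb : ∀ u x → u · (x · x) ∼ₑ u · x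
  ·-square-absorb u x = begin
    u · (x · x)      ≡⟨ cong (λ z → u · (z · x)) (sym (e-identityˡ x)) ⟩
    u · (x ^ 2)      ≈⟨ ∼ₑ-sym (·-square-right u x) ⟩
    u · x            ∎

  pow-absorb : ∀ c x {k} → 0 < k → c · x ^ k ∼ₑ c · x
  pow-absorb c x {suc zero} _ = begin
    c · (e · x)  ≡⟨ cong (c ·_) (e-identityˡ x) ⟩
    c · x        ∎
  pow-absorb c x {suc (suc k)} _ = begin
    c · (x ^ k · x · x)      ≡⟨ cong (c ·_) (·-assoc (x ^ k) x x) ⟩
    c · (x ^ k · (x · x))    ≡⟨ sym (·-assoc c (x ^ k) (x · x)) ⟩
    c · x ^ k · (x · x)      ≈⟨ ·-square-absorb (c · x ^ k) x ⟩
    c · x ^ k · x            ≡⟨ ·-assoc c (x ^ k) x ⟩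
    c · x ^ suc k            ≈⟨ pow-absorb c x {suc k} (s≤s z≤n) ⟩
    c · x                    ∎

  pow-exchange : ∀ c d x {k l} → 0 < k → 0 < l → c · x ^ k · d ∼ₑ c · x ^ l · d
  pow-exchange c d x {k} {l} 0<k 0<l = begin
    c · x ^ k · d      ≈⟨ ·-rotate (c · x ^ k) d ⟩
    d · (c · x ^ k)    ≡⟨ sym (·-assoc d c (x ^ k)) ⟩
    d · c · x ^ k      ≈⟨ pow-absorb (d · c) x 0<k ⟩
    d · c · x          ≈⟨ ∼ₑ-sym (pow-absorb (d · c) x 0<l) ⟩
    d · c · x ^ l      ≡⟨ ·-assoc d c (x ^ l) ⟩
    d · (c · x ^ l)    ≈⟨ ·-rotate d (c · x ^ l) ⟩
    c · x ^ l · d      ∎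

  ·-prodPow-exchange : ∀ n (xs : Vector A n) (ks ls : Vector ℕ n) →
                       (∀ i → 0 < ks i) → (∀ i → 0 < ls i) →
                       ∀ c → c · prodPow n xs ks ∼ₑ c · prodPow n xs ls
  ·-prodPow-exchange zero xs ks ls _ _ c = ∼ₑ-refl
  ·-prodPow-exchange (suc n) xs ks ls 0<ks 0<ls c = begin
    c · (x ^ k · P)    ≡⟨ sym (·-assoc c (x ^ k) P) ⟩
    c · x ^ k · P      ≈⟨ ·-prodPow-exchange n (tail xs) (tail ks) (tail ls)
                            (0<ks ∘ Fin.suc) (0<ls ∘ Fin.suc) (c · x ^ k) ⟩
    c · x ^ k · P′     ≈⟨ pow-exchange c P′ x (0<ks Fin.zero) (0<ls Fin.zero) ⟩
    c · x ^ l · P′     ≡⟨ ·-assoc c (x ^ l) P′ ⟩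
    c · (x ^ l · P′)   ∎
    where
    x : A
    x = head xs
    k l : ℕ
    k = head ks
    l = head ls
    P P′ : A
    P = prodPow n (tail xs) (tail ks)
    P′ = prodPow n (tail xs) (tail ls)

  prodPow-exchange : ∀ n (xs : Vector A n) (ks ls : Vector ℕ n) →
                     (∀ i → 0 < ks i) → (∀ i → 0 < ls i) →
                        prodPow n xs ks ∼ₑ prodPow n xs ls
  prodPow-exchange n xs ks ls 0<ks 0<ls = begin
    prodPow n xs ks        ≡⟨ sym (e-identityˡ _) ⟩
    e · prodPow n xs ks    ≈⟨ ·-prodPow-exchange n xs ks ls 0<ks 0<ls e ⟩
    e · prodPow n xs ls    ≡⟨ e-identityˡ _ ⟩
    prodPow n xs ls        ∎

lemma2p4 : ∀ {a : Level} (𝒜 : HpsUL*ω a) → let open HpsUL*ω 𝒜 in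
    (∀ x y → (x · y ≤ e) ⇔ (x · (y ^ 2) ≤ e))
    × (∀ (n : ℕ) (xs : Vector A n) (ks ls : Vector ℕ n) →
    (∀ i → 0 < ks i) → (∀ i → 0 < ls i) →
    (prodPow n xs ks ≤ e) ⇔ (prodPow n xs ls ≤ e))
lemma2p4 𝒜 = ·-square-right , prodPow-exchange
  where open Absorption 𝒜
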